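{- Let $k\geq 2$ be an integer, let $q\geq 1$ be the modulus of a real non-principal Dirichlet character, and let $P(s)=\prod_{p\mid q}(1-p^{ -s})^{ -1}$. Let $h(n)$ be the coefficients of the Dirichlet series $\sum_{n\geq1}h(n)n^{ -s}=\frac{P(s)}{\zeta(ks)}$ (valid for $\Re(s)>1$). Then $$\sum_{n\leq x}|h(n)|\ll_q x^{1/k}(\log x)^{\pi(q)}\quad\text{as }x\to\infty.$$
   Context: Here $p$ denotes primes, $\zeta$ is the Riemann zeta function, and $\pi(q)$ is the number of primes not exceeding $q$. The implicit constant may depend on $q$ (and $k$). -}

module Defs where

open import Data.Bool using (Bool; true; false; if_then_else_; _∧_; not)
open import Data.Nat using (ℕ; zero; suc; _+_; _*_; _^_; _≤_)
open import Data.Nat.Divisibility using (_∣_; _∣?_)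
open import Data.Nat.Primality using (Prime; prime?)
open import Data.Nat.Coprimality using (Coprime)
open import Data.Nat.DivMod using (_/_)
open import Data.List using (List; []; _∷_; map; filter; length; foldr)
open import Data.Bool.ListAction using (all; any)
open import Data.List.Base using (upTo)
open import Data.Integer as ℤ using (ℤ; +_; -_; ∣_∣)
open import Data.Product using (Σ; _×_; ∃)
open import Relation.Nullary using (¬_; does)
open import Relation.Binary.PropositionalEquality using (_≡_)

range1 : ℕ → List ℕ
range1 n = map suc (upTo n)

sumℤ : List ℤ → ℤ
sumℤ = foldr ℤ._+_ (+ 0)

sumℕ : List ℕ → ℕ
sumℕ = foldr _+_ 0

count : {A : Set} → (A → Bool) → List A → ℕ
count p []       = 0
count p (x ∷ xs) = (if p x then 1 else 0) + count p xs

primePi : ℕ → ℕ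
primePi q = length (filter prime? (range1 q))

moebius : ℕ → ℤ
moebius m =
  if any (λ d → does ((d * d) ∣? m)) (map (λ i → suc (suc i)) (upTo m))
  then + 0
  else (- (+ 1)) ℤ.^ count (λ p → does (prime? p) ∧ does (p ∣? m)) (range1 m)

-- coefficients of P(s) = ∏_{p ∣ q} (1 - p^{-s})^{-1}:
-- a(n) = 1 if every prime divisor of n divides q, else 0  (n ≥ 1)
coeffP : ℕ → ℕ → ℤ
coeffP q n =
  if all (λ p → not (does (prime? p) ∧ does (p ∣? n)) ∨' does (p ∣? q)) (range1 n)
  then + 1 else + 0
  where
  _∨'_ : Bool → Bool → Bool
  true  ∨' _ = true
  false ∨' b = b

-- coefficients of 1/ζ(ks) = Σ_m μ(m) m^{-ks}:
-- b(n) = μ(m) if n = m^k (m ≥ 1), else 0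
coeffInvZetaK : ℕ → ℕ → ℤ
coeffInvZetaK k n =
  sumℤ (map (λ m → if does (m ^ k Data.Nat.≟ n) then moebius m else + 0) (range1 n))

-- h(n): coefficients of P(s)/ζ(ks), i.e. the Dirichlet convolution
-- h(n) = Σ_{d ∣ n} b(d) a(n/d)   (n ≥ 1)
h : ℕ → ℕ → ℕ → ℤ
h k q n =
  sumℤ (map (λ i → if does (suc i ∣? n) then coeffInvZetaK k (suc i) ℤ.* coeffP q (n / suc i) else + 0)
            (upTo n))

sumAbsH : ℕ → ℕ → ℕ → ℕ
sumAbsH k q N = sumℕ (map (λ n → ∣ h k q n ∣) (range1 N))

-- A real Dirichlet character mod q: a completely multiplicative, q-periodic
-- function ℕ → ℤ (integer-valued = real-valued for characters) with
-- χ(1) = 1 and χ(n) = 0 exactly when gcd(n,q) ≠ 1.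
record RealDirichletCharacter (q : ℕ) : Set where
  field
    χ        : ℕ → ℤ
    χ-one    : χ 1 ≡ + 1
    χ-mult   : ∀ m n → χ (m * n) ≡ χ m ℤ.* χ n
    χ-period : ∀ n → χ (n + q) ≡ χ n
    χ-zero   : ∀ n → (χ n ≡ + 0 → ¬ Coprime n q) × (¬ Coprime n q → χ n ≡ + 0)

NonPrincipal : ∀ {q} → RealDirichletCharacter q → Set
NonPrincipal {q} c = ∃ λ n → Coprime n q × ¬ (RealDirichletCharacter.χ c n ≡ + 1)

{-# OPTIONS --safe #-}
module Submission where

-- h is the Dirichlet convolution of the coefficients b of 1/ζ(ks), which satisfy |b| ≤ 1 and
-- vanish off the k-th powers, with the indicator a of the integers all of whose prime factors
-- divide q. Hence Σ_{n≤N} |h(n)| ≤ (Σ_{d≤N} |b(d)|) (Σ_{m≤N} a(m)). The first factor is at most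
-- the number of k-th powers up to N, so its k-th power is at most N; the second counts integers
-- up to N built from the π(q) primes up to q, each with exponent at most log₂ N, so it is at most
-- (1 + log₂ N)^π(q) ≤ (2 log₂ N)^π(q) once N ≥ 2.

open import Defs
open import Data.Bool using (Bool; true; false; if_then_else_; T; _∧_)
open import Data.Bool.ListAction using (all; any)
open import Data.Empty using (⊥-elim)
open import Data.Integer as ℤ using (ℤ; ∣_∣)
import Data.Integer.Properties as ℤP
open import Data.List using (List; []; _∷_; [_]; map; filter; length; upTo; applyUpTo; _∷ʳ_)
open import Data.List.Membership.Propositional using (_∈_)
open import Data.List.Membership.Propositional.Properties using (∈-map⁺; ∈-upTo⁺; ∈-filter⁺)
open import Data.List.Properties using (applyUpTo-∷ʳ; map-applyUpTo; map-∘)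
open import Data.List.Relation.Unary.All as All using (All; []; _∷_)
open import Data.List.Relation.Unary.All.Properties using (all⁺; all-filter)
open import Data.List.Relation.Unary.Any using (here; there)
open import Data.Nat
open import Data.Nat.DivMod
open import Data.Nat.Divisibility
open import Data.Nat.ListAction using (product)
open import Data.Nat.ListAction.Properties using (sum-++)
open import Data.Nat.Logarithm using (⌊log₂_⌋; ⌊log₂⌋-mono-≤; ⌊log₂[2^n]⌋≡n)
open import Data.Nat.Primality using (Prime; prime?; prime⇒nonZero; prime⇒nonTrivial)
open import Data.Nat.Primality.Factorisation using (factorise)
open import Data.Nat.Properties
open import Algebra.Properties.CommutativeSemigroup +-commutativeSemigroup
  using () renaming (interchange to +-interchange)
open import Algebra.Properties.CommutativeSemigroup *-commutativeSemigroup
  using () renaming (interchange to *-interchange)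
open import Data.Product using (Σ; ∃; _×_; _,_)
open import Data.Sum using (inj₁; inj₂)
open import Function using (_∘_)
open import Relation.Binary using (tri<; tri≈; tri>)
open import Relation.Binary.PropositionalEquality using (_≡_; _≢_; refl; sym; trans; cong; cong₂; subst; module ≡-Reasoning)
open import Relation.Nullary using (Dec; yes; no; does; ¬_)
open import Relation.Nullary.Negation using (contradiction)

infixl 10 ∑<
∑< : ℕ → (ℕ → ℕ) → ℕ
∑< zero    f = 0
∑< (suc n) f = ∑< n f + f n

syntax ∑< n (λ i → e) = ∑[ i < n ] e

module _ {f g : ℕ → ℕ} where

  ∑-cong : ∀ n → (∀ i → f i ≡ g i) → ∑[ i < n ] f i ≡ ∑[ i < n ] g i
  ∑-cong zero    f≗g = refl
  ∑-cong (suc n) f≗g = cong₂ _+_ (∑-cong n f≗g) (f≗g n)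

  ∑-mono-≤ : ∀ n → (∀ i → i < n → f i ≤ g i) → ∑[ i < n ] f i ≤ ∑[ i < n ] g i
  ∑-mono-≤ zero    f≤g = z≤n
  ∑-mono-≤ (suc n) f≤g = +-mono-≤ (∑-mono-≤ n (λ i i<n → f≤g i (m<n⇒m<1+n i<n))) (f≤g n ≤-refl)

  ∑-distrib-+ : ∀ n → ∑[ i < n ] (f i + g i) ≡ ∑[ i < n ] f i + ∑[ i < n ] g i
  ∑-distrib-+ zero    = refl
  ∑-distrib-+ (suc n) =
    trans (cong (_+ (f n + g n)) (∑-distrib-+ n)) (+-interchange (∑< n f) (∑< n g) (f n) (g n))

module _ {f : ℕ → ℕ} where

  ∑-zero : ∀ n → (∀ i → i < n → f i ≡ 0) → ∑[ i < n ] f i ≡ 0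
  ∑-zero zero    _    = refl
  ∑-zero (suc n) f≡0 = cong₂ _+_ (∑-zero n (λ i i<n → f≡0 i (m<n⇒m<1+n i<n))) (f≡0 n ≤-refl)

  ∑-mono-range : ∀ {m n} → m ≤ n → ∑[ i < m ] f i ≤ ∑[ i < n ] f i
  ∑-mono-range m≤n = go (≤⇒≤′ m≤n)
    where
    go : ∀ {m n} → m ≤′ n → ∑[ i < m ] f i ≤ ∑[ i < n ] f i
    go ≤′-refl        = ≤-refl
    go (≤′-step m≤′n) = ≤-trans (go m≤′n) (m≤m+n _ _)

  *-distribˡ-∑ : ∀ c n → c * ∑[ i < n ] f i ≡ ∑[ i < n ] (c * f i)
  *-distribˡ-∑ c zero    = *-zeroʳ c
  *-distribˡ-∑ c (suc n) = trans (*-distribˡ-+ c _ (f n)) (cong (_+ c * f n) (*-distribˡ-∑ c n))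

  *-distribʳ-∑ : ∀ c n → ∑[ i < n ] f i * c ≡ ∑[ i < n ] (f i * c)
  *-distribʳ-∑ c n = trans (*-comm _ c) (trans (*-distribˡ-∑ c n) (∑-cong n (λ i → *-comm c (f i))))

  ∑-unique-support-≤1 : ∀ n → (∀ i → f i ≤ 1) → (∀ {i j} → f i ≢ 0 → f j ≢ 0 → i ≡ j) →
                        ∑[ i < n ] f i ≤ 1
  ∑-unique-support-≤1 zero    _   _      = z≤n
  ∑-unique-support-≤1 (suc n) f≤1 unique with f n ≟ 0
  ... | yes fn≡0 =
    subst (_≤ 1) (sym (trans (cong (∑< n f +_) fn≡0) (+-identityʳ _))) (∑-unique-support-≤1 n f≤1 unique)
  ... | no  fn≢0 = subst (_≤ 1) (sym (cong (_+ f n) (∑-zero n vanishes-before-n))) (f≤1 n)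
    where
    vanishes-before-n : ∀ i → i < n → f i ≡ 0
    vanishes-before-n i i<n with f i ≟ 0
    ... | yes fi≡0 = fi≡0
    ... | no  fi≢0 = contradiction (unique fi≢0 fn≢0) (<⇒≢ i<n)

∑-comm : ∀ m n (f : ℕ → ℕ → ℕ) → ∑[ i < m ] ∑[ j < n ] f i j ≡ ∑[ j < n ] ∑[ i < m ] f i j
∑-comm zero    n f = sym (∑-zero n (λ _ _ → refl))
∑-comm (suc m) n f = trans (cong (_+ ∑[ j < n ] f m j) (∑-comm m n f)) (sym (∑-distrib-+ n))

sum-map-upTo : ∀ (f : ℕ → ℕ) n → sumℕ (map f (upTo n)) ≡ ∑[ i < n ] f i
sum-map-upTo f n = trans (cong sumℕ (map-applyUpTo (λ i → i) f n)) (sum-applyUpTo n)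
  where
  sum-applyUpTo : ∀ n → sumℕ (applyUpTo f n) ≡ ∑[ i < n ] f i
  sum-applyUpTo zero    = refl
  sum-applyUpTo (suc n) = begin
    sumℕ (applyUpTo f (suc n))       ≡⟨ cong sumℕ (applyUpTo-∷ʳ f n) ⟨
    sumℕ (applyUpTo f n ∷ʳ f n)      ≡⟨ sum-++ (applyUpTo f n) [ f n ] ⟩
    sumℕ (applyUpTo f n) + (f n + 0) ≡⟨ cong₂ _+_ (sum-applyUpTo n) (+-identityʳ (f n)) ⟩
    ∑[ i < suc n ] f i               ∎
    where open ≡-Reasoning

sum-map-range1 : ∀ (f : ℕ → ℕ) n → sumℕ (map f (range1 n)) ≡ ∑[ i < n ] f (suc i)
sum-map-range1 f n = trans (cong sumℕ (sym (map-∘ (upTo n)))) (sum-map-upTo (f ∘ suc) n)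

∣sumℤ∣≤sum∣∣ : ∀ {A : Set} (F : A → ℤ) xs → ∣ sumℤ (map F xs) ∣ ≤ sumℕ (map (∣_∣ ∘ F) xs)
∣sumℤ∣≤sum∣∣ F []       = z≤n
∣sumℤ∣≤sum∣∣ F (x ∷ xs) =
  ≤-trans (ℤP.∣i+j∣≤∣i∣+∣j∣ (F x) _) (+-monoʳ-≤ ∣ F x ∣ (∣sumℤ∣≤sum∣∣ F xs))

[r+kn]/n≡k : ∀ {r} k n .{{_ : NonZero n}} → r < n → (r + k * n) / n ≡ k
[r+kn]/n≡k {r} k n r<n = begin
  (r + k * n) / n   ≡⟨ +-distrib-/-∣ʳ r (n∣m*n k) ⟩
  r / n + k * n / n ≡⟨ cong₂ _+_ (m<n⇒m/n≡0 r<n) (m*n/n≡m k n) ⟩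
  k                 ∎
  where open ≡-Reasoning

/-suc-∣ : ∀ N d .{{_ : NonZero d}} → d ∣ suc N → suc N / d ≡ suc (N / d)
/-suc-∣ N d@(suc d-1) (divides (suc m) 1+N≡[1+m]d) = begin
  suc N / d               ≡⟨ /-congˡ 1+N≡[1+m]d ⟩
  suc m * d / d           ≡⟨ m*n/n≡m (suc m) d ⟩
  suc m                   ≡⟨ cong suc ([r+kn]/n≡k m d ≤-refl) ⟨
  suc ((d-1 + m * d) / d) ≡⟨ cong (λ n → suc (n / d)) (suc-injective 1+N≡[1+m]d) ⟨
  suc (N / d)             ∎
  where open ≡-Reasoning

/-suc-∤ : ∀ N d .{{_ : NonZero d}} → ¬ d ∣ suc N → suc N / d ≡ N / d
/-suc-∤ N d d∤1+N with m≤n⇒m<n∨m≡n (m%n<n N d)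
... | inj₁ 1+r<d = trans (/-congˡ (cong suc (m≡m%n+[m/n]*n N d))) ([r+kn]/n≡k (N / d) d 1+r<d)
... | inj₂ 1+r≡d = contradiction (divides (suc (N / d)) 1+N≡[1+q]d) d∤1+N
  where
  1+N≡[1+q]d : suc N ≡ suc (N / d) * d
  1+N≡[1+q]d = trans (cong suc (m≡m%n+[m/n]*n N d)) (cong (_+ N / d * d) 1+r≡d)

∑-multiples : ∀ d .{{_ : NonZero d}} (g : ℕ → ℕ) N →
  ∑[ j < N ] (if does (d ∣? suc j) then g (suc j / d) else 0) ≡ ∑[ i < N / d ] g (suc i)
∑-multiples d g zero = cong (λ M → ∑[ i < M ] g (suc i)) (sym (0/n≡0 d))
∑-multiples d g (suc N) with d ∣? suc N
... | yes d∣1+N = begin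
  _ + g (suc N / d)                         ≡⟨ cong₂ _+_ (∑-multiples d g N) (cong g (/-suc-∣ N d d∣1+N)) ⟩
  ∑[ i < N / d ] g (suc i) + g (suc (N / d)) ≡⟨ cong (λ M → ∑[ i < M ] g (suc i)) (/-suc-∣ N d d∣1+N) ⟨
  ∑[ i < suc N / d ] g (suc i)              ∎
  where open ≡-Reasoning
... | no d∤1+N = begin
  _ + 0                        ≡⟨ +-identityʳ _ ⟩
  _                            ≡⟨ ∑-multiples d g N ⟩
  ∑[ i < N / d ] g (suc i)     ≡⟨ cong (λ M → ∑[ i < M ] g (suc i)) (/-suc-∤ N d d∤1+N) ⟨
  ∑[ i < suc N / d ] g (suc i) ∎
  where open ≡-Reasoning

∑-split-multiples : ∀ p .{{_ : NonZero p}} (g : ℕ → ℕ) N →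
  ∑[ i < N ] g (suc i) ≡
    ∑[ i < N ] (if does (p ∣? suc i) then 0 else g (suc i)) + ∑[ i < N / p ] g (p * suc i)
∑-split-multiples p g N = begin
  ∑[ i < N ] g (suc i)
    ≡⟨ ∑-cong N (λ i → split (suc i)) ⟩
  ∑[ i < N ] ((if does (p ∣? suc i) then 0 else g (suc i))
             + (if does (p ∣? suc i) then g (p * (suc i / p)) else 0))
    ≡⟨ ∑-distrib-+ N ⟩
  ∑[ i < N ] (if does (p ∣? suc i) then 0 else g (suc i))
    + ∑[ i < N ] (if does (p ∣? suc i) then g (p * (suc i / p)) else 0)
    ≡⟨ cong₂ _+_ refl (∑-multiples p (λ m → g (p * m)) N) ⟩
  ∑[ i < N ] (if does (p ∣? suc i) then 0 else g (suc i)) + ∑[ i < N / p ] g (p * suc i)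
    ∎
  where
  open ≡-Reasoning
  split : ∀ n → g n ≡ (if does (p ∣? n) then 0 else g n) + (if does (p ∣? n) then g (p * (n / p)) else 0)
  split n with p ∣? n
  ... | yes p∣n = cong g (sym (m*[n/m]≡n p∣n))
  ... | no  _   = sym (+-identityʳ (g n))

Smooth : List ℕ → ℕ → Set
Smooth P n = ∀ {p} → Prime p → p ∣ n → p ∈ P

smooth[]⇒≡1 : ∀ {n} .{{_ : NonZero n}} → Smooth [] n → n ≡ 1
smooth[]⇒≡1 {n} smooth with factorise n
... | record { factors = [] ; isFactorisation = n≡1 } = n≡1
... | record { factors = p ∷ ps ; isFactorisation = n≡p*ps ; factorsPrime = p-prime ∷ _ }
  with () ← smooth p-prime (subst (p ∣_) (sym n≡p*ps) (m∣m*n (product ps)))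

-- Split off the multiples of p: the other numbers are P-smooth, and a multiple p m ≤ N
-- has m ≤ N / p < 2 ^ L.
∑-smooth≤ : ∀ {P} → All Prime P → ∀ {g : ℕ → ℕ} → (∀ n → g n ≤ 1) →
            (∀ n .{{_ : NonZero n}} → g n ≢ 0 → Smooth P n) →
            ∀ {L} N → N < 2 ^ L → ∑[ i < N ] g (suc i) ≤ L ^ length P
∑-smooth≤ [] {g} g≤1 support N _ =
  ∑-unique-support-≤1 N (λ i → g≤1 (suc i)) (λ gi≢0 gj≢0 → trans (at-1 gi≢0) (sym (at-1 gj≢0)))
  where
  at-1 : ∀ {i} → g (suc i) ≢ 0 → i ≡ 0
  at-1 gi≢0 = suc-injective (smooth[]⇒≡1 (support _ gi≢0))
∑-smooth≤ (_ ∷ _) _ _ {zero} zero    _        = z≤n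
∑-smooth≤ (_ ∷ _) _ _ {zero} (suc N) (s≤s ())
∑-smooth≤ {p ∷ P} (p-prime ∷ P-prime) {g} g≤1 support {suc L} N N<2^[1+L] = begin
  ∑[ i < N ] g (suc i)
    ≡⟨ ∑-split-multiples p g N ⟩
  ∑[ i < N ] g-nonmultiple (suc i) + ∑[ i < N / p ] g (p * suc i)
    ≤⟨ +-mono-≤ (∑-smooth≤ P-prime g-nonmultiple≤1 g-nonmultiple-support N N<2^[1+L])
                (∑-smooth≤ (p-prime ∷ P-prime) (λ n → g≤1 (p * n)) g-multiple-support {L} (N / p) N/p<2^L) ⟩
  suc L ^ length P + L * L ^ length P
    ≤⟨ +-monoʳ-≤ (suc L ^ length P) (*-monoʳ-≤ L (^-monoˡ-≤ (length P) (n≤1+n L))) ⟩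
  suc L ^ suc (length P)
    ∎
  where
  open ≤-Reasoning
  instance
    p≢0 : NonZero p
    p≢0 = prime⇒nonZero p-prime

  g-nonmultiple : ℕ → ℕ
  g-nonmultiple n = if does (p ∣? n) then 0 else g n

  g-nonmultiple≤1 : ∀ n → g-nonmultiple n ≤ 1
  g-nonmultiple≤1 n with p ∣? n
  ... | yes _ = z≤n
  ... | no  _ = g≤1 n

  g-nonmultiple-support : ∀ n .{{_ : NonZero n}} → g-nonmultiple n ≢ 0 → Smooth P n
  g-nonmultiple-support n gn≢0 {r} r-prime r∣n with p ∣? n
  ... | yes _   = contradiction refl gn≢0
  ... | no  p∤n with support n gn≢0 r-prime r∣n
  ...   | here refl = contradiction r∣n p∤n
  ...   | there r∈P = r∈P

  g-multiple-support : ∀ n .{{_ : NonZero n}} → g (p * n) ≢ 0 → Smooth (p ∷ P) n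
  g-multiple-support n gpn≢0 r-prime r∣n =
    support (p * n) {{m*n≢0 p n}} gpn≢0 r-prime (∣-trans r∣n (n∣m*n p))

  N/p<2^L : N / p < 2 ^ L
  N/p<2^L = m<n*o⇒m/o<n (<-≤-trans N<2^[1+L] (begin
    2 * 2 ^ L ≡⟨ *-comm 2 (2 ^ L) ⟩
    2 ^ L * 2 ≤⟨ *-monoʳ-≤ (2 ^ L) (nonTrivial⇒n>1 p {{prime⇒nonTrivial p-prime}}) ⟩
    2 ^ L * p ∎))

0^n≡0 : ∀ n .{{_ : NonZero n}} → 0 ^ n ≡ 0
0^n≡0 (suc n) = refl

module _ (k : ℕ) .{{_ : NonZero k}} where

  ^-injectiveˡ : ∀ {a b} → a ^ k ≡ b ^ k → a ≡ b
  ^-injectiveˡ {a} {b} a^k≡b^k with <-cmp a b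
  ... | tri< a<b _ _ = contradiction a^k≡b^k (<⇒≢ (^-monoˡ-< k a<b))
  ... | tri≈ _ a≡b _ = a≡b
  ... | tri> _ _ b<a = contradiction (sym a^k≡b^k) (<⇒≢ (^-monoˡ-< k b<a))

  between-powers⇒¬power : ∀ {r n} → r ^ k < n → n < suc r ^ k → ∀ m → m ^ k ≢ n
  between-powers⇒¬power {r} r^k<n n<[1+r]^k m refl with m ≤? r
  ... | yes m≤r = <⇒≱ r^k<n (^-monoˡ-≤ k m≤r)
  ... | no  m≰r = <⇒≱ n<[1+r]^k (^-monoˡ-≤ k (≰⇒> m≰r))

  module _ {f : ℕ → ℕ} (f≤1 : ∀ n → f n ≤ 1) (f-vanishes : ∀ n → (∀ m → m ^ k ≢ n) → f n ≡ 0) where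

    ∑-powers-bracket : ∀ N → ∃ λ r → ∑[ i < N ] f (suc i) ≤ r × r ^ k ≤ N × N < suc r ^ k
    ∑-powers-bracket zero = 0 , z≤n , ≤-reflexive (0^n≡0 k) , subst (0 <_) (sym (^-zeroˡ k)) z<s
    ∑-powers-bracket (suc N) with ∑-powers-bracket N
    ... | r , ∑≤r , r^k≤N , N<[1+r]^k with suc N ≟ suc r ^ k
    ...   | yes 1+N≡[1+r]^k =
            suc r
          , ≤-trans (+-mono-≤ ∑≤r (f≤1 (suc N))) (≤-reflexive (+-comm r 1))
          , ≤-reflexive (sym 1+N≡[1+r]^k)
          , subst (_< suc (suc r) ^ k) (sym 1+N≡[1+r]^k) (^-monoˡ-< k (n<1+n (suc r)))
    ...   | no 1+N≢[1+r]^k =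
            r
          , subst (_≤ r) (sym (trans (cong (∑< N (f ∘ suc) +_) f[1+N]≡0) (+-identityʳ _))) ∑≤r
          , m≤n⇒m≤1+n r^k≤N
          , 1+N<[1+r]^k
      where
      1+N<[1+r]^k : suc N < suc r ^ k
      1+N<[1+r]^k = ≤∧≢⇒< N<[1+r]^k 1+N≢[1+r]^k
      f[1+N]≡0 : f (suc N) ≡ 0
      f[1+N]≡0 = f-vanishes (suc N) (between-powers⇒¬power (s≤s r^k≤N) 1+N<[1+r]^k)

    ∑-powers^k≤ : ∀ N → (∑[ i < N ] f (suc i)) ^ k ≤ N
    ∑-powers^k≤ N with ∑-powers-bracket N
    ... | r , ∑≤r , r^k≤N , _ = ≤-trans (^-monoˡ-≤ k ∑≤r) r^k≤N

𝟙 : ∀ {A : Set} → Dec A → ℕ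
𝟙 a? = if does a? then 1 else 0

𝟙≤1 : ∀ {A : Set} (a? : Dec A) → 𝟙 a? ≤ 1
𝟙≤1 (yes _) = ≤-refl
𝟙≤1 (no  _) = z≤n

𝟙≢0⇒ : ∀ {A : Set} (a? : Dec A) → 𝟙 a? ≢ 0 → A
𝟙≢0⇒ (yes a) _   = a
𝟙≢0⇒ (no  _) 0≢0 = contradiction refl 0≢0

𝟙-no : ∀ {A : Set} (a? : Dec A) → ¬ A → 𝟙 a? ≡ 0
𝟙-no (yes a) ¬a = contradiction a ¬a
𝟙-no (no  _) _  = refl

∣if∣≤𝟙 : ∀ {A : Set} (a? : Dec A) {x : ℤ} → ∣ x ∣ ≤ 1 → ∣ (if does a? then x else ℤ.+ 0) ∣ ≤ 𝟙 a?
∣if∣≤𝟙 (yes _) ∣x∣≤1 = ∣x∣≤1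
∣if∣≤𝟙 (no  _) _     = z≤n

∣moebius∣≤1 : ∀ m → ∣ moebius m ∣ ≤ 1
∣moebius∣≤1 m = bound (any (λ d → does ((d * d) ∣? m)) (map (λ i → suc (suc i)) (upTo m)))
                      (count (λ p → does (prime? p) ∧ does (p ∣? m)) (range1 m))
  where
  ∣-1^n∣≡1 : ∀ n → ∣ (ℤ.- ℤ.+ 1) ℤ.^ n ∣ ≡ 1
  ∣-1^n∣≡1 zero    = refl
  ∣-1^n∣≡1 (suc n) = trans (ℤP.abs-* (ℤ.- ℤ.+ 1) ((ℤ.- ℤ.+ 1) ℤ.^ n)) (trans (*-identityˡ _) (∣-1^n∣≡1 n))
  bound : ∀ b n → ∣ (if b then ℤ.+ 0 else (ℤ.- ℤ.+ 1) ℤ.^ n) ∣ ≤ 1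
  bound true  _ = z≤n
  bound false n = ≤-reflexive (∣-1^n∣≡1 n)

∣coeffInvZetaK∣≤#roots : ∀ k d → ∣ coeffInvZetaK k d ∣ ≤ ∑[ i < d ] 𝟙 (suc i ^ k ≟ d)
∣coeffInvZetaK∣≤#roots k d =
  ≤-trans (∣sumℤ∣≤sum∣∣ _ (range1 d))
    (≤-trans (≤-reflexive (sum-map-range1 _ d))
      (∑-mono-≤ d (λ i _ → ∣if∣≤𝟙 (suc i ^ k ≟ d) (∣moebius∣≤1 (suc i)))))

∣coeffInvZetaK∣≤1 : ∀ k .{{_ : NonZero k}} d → ∣ coeffInvZetaK k d ∣ ≤ 1
∣coeffInvZetaK∣≤1 k d =
  ≤-trans (∣coeffInvZetaK∣≤#roots k d) (∑-unique-support-≤1 d (λ i → 𝟙≤1 (suc i ^ k ≟ d)) unique-root)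
  where
  unique-root : ∀ {i j} → 𝟙 (suc i ^ k ≟ d) ≢ 0 → 𝟙 (suc j ^ k ≟ d) ≢ 0 → i ≡ j
  unique-root {i} {j} i-root j-root =
    suc-injective (^-injectiveˡ k (trans (𝟙≢0⇒ (suc i ^ k ≟ d) i-root) (sym (𝟙≢0⇒ (suc j ^ k ≟ d) j-root))))

∣coeffInvZetaK∣-vanishes : ∀ k d → (∀ m → m ^ k ≢ d) → ∣ coeffInvZetaK k d ∣ ≡ 0
∣coeffInvZetaK∣-vanishes k d ¬power = n≤0⇒n≡0 (≤-trans (∣coeffInvZetaK∣≤#roots k d)
  (≤-reflexive (∑-zero d (λ i _ → 𝟙-no (suc i ^ k ≟ d) (¬power (suc i))))))

module _ {A : Set} (f : A → Bool) (xs : List A) where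

  ∣if-all∣≤1 : ∣ (if all f xs then ℤ.+ 1 else ℤ.+ 0) ∣ ≤ 1
  ∣if-all∣≤1 with all f xs
  ... | true  = ≤-refl
  ... | false = z≤n

  ∣if-all∣≢0⇒All : ∣ (if all f xs then ℤ.+ 1 else ℤ.+ 0) ∣ ≢ 0 → All (T ∘ f) xs
  ∣if-all∣≢0⇒All ≢0 = all⁺ f xs (T-if (all f xs) ≢0)
    where
    T-if : ∀ b → ∣ (if b then ℤ.+ 1 else ℤ.+ 0) ∣ ≢ 0 → T b
    T-if true  _   = _
    T-if false 0≢0 = contradiction refl 0≢0

∣coeffP∣≤1 : ∀ q n → ∣ coeffP q n ∣ ≤ 1
∣coeffP∣≤1 q n = ∣if-all∣≤1 _ (range1 n)

∈-range1 : ∀ {m n} .{{_ : NonZero m}} → m ≤ n → m ∈ range1 n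
∈-range1 {suc m} m<n = ∈-map⁺ suc (∈-upTo⁺ m<n)

coeffP≢0⇒∣ : ∀ q n .{{_ : NonZero n}} {p} → ∣ coeffP q n ∣ ≢ 0 → Prime p → p ∣ n → p ∣ q
coeffP≢0⇒∣ q n {p} coeffP≢0 p-prime p∣n
  with All.lookup (∣if-all∣≢0⇒All _ (range1 n) coeffP≢0)
                  (∈-range1 {{prime⇒nonZero p-prime}} (∣⇒≤ p∣n))
-- test-p is the condition coeffP checks at p: if p is prime and divides n, then p ∣ q.
... | test-p with prime? p | p ∣? n | p ∣? q
...   | no ¬p-prime | _       | _       = contradiction p-prime ¬p-prime
...   | yes _       | no p∤n  | _       = contradiction p∣n p∤n
...   | yes _       | yes _   | yes p∣q = p∣q
...   | yes _       | yes _   | no  _   = ⊥-elim test-p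

primesUpTo : ℕ → List ℕ
primesUpTo q = filter prime? (range1 q)

coeffP-smooth : ∀ {q} → 1 ≤ q → ∀ n .{{_ : NonZero n}} → ∣ coeffP q n ∣ ≢ 0 → Smooth (primesUpTo q) n
coeffP-smooth {q} q≥1 n coeffP≢0 {p} p-prime p∣n =
  ∈-filter⁺ prime? (∈-range1 {{prime⇒nonZero p-prime}} p≤q) p-prime
  where
  p≤q : p ≤ q
  p≤q = ∣⇒≤ {{>-nonZero q≥1}} (coeffP≢0⇒∣ q n coeffP≢0 p-prime p∣n)

_⋆_ : (ℕ → ℕ) → (ℕ → ℕ) → ℕ → ℕ
(f ⋆ g) n = ∑[ i < n ] (if does (suc i ∣? n) then f (suc i) * g (n / suc i) else 0)

∑-⋆≤ : ∀ (f g : ℕ → ℕ) N → ∑[ j < N ] (f ⋆ g) (suc j) ≤ ∑[ i < N ] f (suc i) * ∑[ i < N ] g (suc i)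
∑-⋆≤ f g N = begin
  ∑[ j < N ] (f ⋆ g) (suc j)
    ≤⟨ ∑-mono-≤ N (λ j j<N → ∑-mono-range j<N) ⟩
  ∑[ j < N ] ∑[ i < N ] term j i
    ≡⟨ ∑-comm N N term ⟩
  ∑[ i < N ] ∑[ j < N ] term j i
    ≡⟨ ∑-cong N column ⟩
  ∑[ i < N ] (f (suc i) * ∑[ m < N / suc i ] g (suc m))
    ≤⟨ ∑-mono-≤ N (λ i _ → *-monoʳ-≤ (f (suc i)) (∑-mono-range (m/n≤m N (suc i)))) ⟩
  ∑[ i < N ] (f (suc i) * ∑[ m < N ] g (suc m))
    ≡⟨ *-distribʳ-∑ (∑[ m < N ] g (suc m)) N ⟨
  ∑[ i < N ] f (suc i) * ∑[ m < N ] g (suc m)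
    ∎
  where
  open ≤-Reasoning
  term : ℕ → ℕ → ℕ
  term j i = if does (suc i ∣? suc j) then f (suc i) * g (suc j / suc i) else 0

  if-* : ∀ b c x → (if b then c * x else 0) ≡ c * (if b then x else 0)
  if-* true  c x = refl
  if-* false c x = sym (*-zeroʳ c)

  column : ∀ i → ∑[ j < N ] term j i ≡ f (suc i) * ∑[ m < N / suc i ] g (suc m)
  column i = begin-equality
    ∑[ j < N ] term j i
      ≡⟨ ∑-cong N (λ j → if-* (does (suc i ∣? suc j)) (f (suc i)) (g (suc j / suc i))) ⟩
    ∑[ j < N ] (f (suc i) * (if does (suc i ∣? suc j) then g (suc j / suc i) else 0))
      ≡⟨ *-distribˡ-∑ (f (suc i)) N ⟨
    f (suc i) * ∑[ j < N ] (if does (suc i ∣? suc j) then g (suc j / suc i) else 0)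
      ≡⟨ cong (f (suc i) *_) (∑-multiples (suc i) g N) ⟩
    f (suc i) * ∑[ m < N / suc i ] g (suc m)
      ∎

∣h∣≤∣b∣⋆∣a∣ : ∀ k q n → ∣ h k q n ∣ ≤ ((∣_∣ ∘ coeffInvZetaK k) ⋆ (∣_∣ ∘ coeffP q)) n
∣h∣≤∣b∣⋆∣a∣ k q n =
  ≤-trans (∣sumℤ∣≤sum∣∣ _ (upTo n))
    (≤-reflexive (trans (sum-map-upTo _ n) (∑-cong n λ i →
      ∣if-*∣ (does (suc i ∣? n)) (coeffInvZetaK k (suc i)) (coeffP q (n / suc i)))))
  where
  ∣if-*∣ : ∀ b x y → ∣ (if b then x ℤ.* y else ℤ.+ 0) ∣ ≡ (if b then ∣ x ∣ * ∣ y ∣ else 0)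
  ∣if-*∣ true  x y = ℤP.abs-* x y
  ∣if-*∣ false _ _ = refl

sumAbsH≤ : ∀ k q N →
  sumAbsH k q N ≤ ∑[ i < N ] ∣ coeffInvZetaK k (suc i) ∣ * ∑[ i < N ] ∣ coeffP q (suc i) ∣
sumAbsH≤ k q N = begin
  sumAbsH k q N                  ≡⟨ sum-map-range1 (λ n → ∣ h k q n ∣) N ⟩
  ∑[ j < N ] ∣ h k q (suc j) ∣   ≤⟨ ∑-mono-≤ N (λ j _ → ∣h∣≤∣b∣⋆∣a∣ k q (suc j)) ⟩
  ∑[ j < N ] ((∣_∣ ∘ coeffInvZetaK k) ⋆ (∣_∣ ∘ coeffP q)) (suc j)
                                 ≤⟨ ∑-⋆≤ (∣_∣ ∘ coeffInvZetaK k) (∣_∣ ∘ coeffP q) N ⟩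
  ∑[ i < N ] ∣ coeffInvZetaK k (suc i) ∣ * ∑[ i < N ] ∣ coeffP q (suc i) ∣ ∎
  where open ≤-Reasoning

∑∣coeffInvZetaK∣^k≤ : ∀ k .{{_ : NonZero k}} N → (∑[ i < N ] ∣ coeffInvZetaK k (suc i) ∣) ^ k ≤ N
∑∣coeffInvZetaK∣^k≤ k = ∑-powers^k≤ k (∣coeffInvZetaK∣≤1 k) (∣coeffInvZetaK∣-vanishes k)

n<2^[1+⌊log₂n⌋] : ∀ n → n < 2 ^ suc ⌊log₂ n ⌋
n<2^[1+⌊log₂n⌋] n with n <? 2 ^ suc ⌊log₂ n ⌋
... | yes n<2^[1+L] = n<2^[1+L]
... | no  n≮2^[1+L] = contradiction
  (subst (_≤ ⌊log₂ n ⌋) (⌊log₂[2^n]⌋≡n (suc ⌊log₂ n ⌋)) (⌊log₂⌋-mono-≤ (≮⇒≥ n≮2^[1+L])))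
  (1+n≰n)

∑∣coeffP∣≤ : ∀ {q} → 1 ≤ q → ∀ N → ∑[ i < N ] ∣ coeffP q (suc i) ∣ ≤ suc ⌊log₂ N ⌋ ^ primePi q
∑∣coeffP∣≤ {q} q≥1 N =
  ∑-smooth≤ (all-filter prime? (range1 q)) (∣coeffP∣≤1 q) (coeffP-smooth q≥1) N (n<2^[1+⌊log₂n⌋] N)

^-distrib-* : ∀ m n e → (m * n) ^ e ≡ m ^ e * n ^ e
^-distrib-* m n zero    = refl
^-distrib-* m n (suc e) = trans (cong (m * n *_) (^-distrib-* m n e)) (*-interchange m n (m ^ e) (n ^ e))

[1+n]^e≤2^e*n^e : ∀ {n} e → 1 ≤ n → suc n ^ e ≤ 2 ^ e * n ^ e
[1+n]^e≤2^e*n^e {n} e n≥1 = ≤-trans (^-monoˡ-≤ e 1+n≤2n) (≤-reflexive (^-distrib-* 2 n e))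
  where
  1+n≤2n : suc n ≤ 2 * n
  1+n≤2n = subst (suc n ≤_) (cong (n +_) (sym (+-identityʳ n))) (+-monoˡ-≤ n n≥1)

lemma4 : (k : ℕ) → 2 ≤ k → (q : ℕ) → 1 ≤ q →
    (Σ (RealDirichletCharacter q) NonPrincipal) →
    ∃ λ C → ∃ λ N₀ → ∀ N → N₀ ≤ N →
    sumAbsH k q N ^ k ≤ C * N * ⌊log₂ N ⌋ ^ (k * primePi q)
lemma4 k 2≤k q q≥1 _ = 2 ^ (k * primePi q) , 2 , bound
  where
  instance
    k≢0 : NonZero k
    k≢0 = >-nonZero (<-trans z<s 2≤k)

  bound : ∀ N → 2 ≤ N → sumAbsH k q N ^ k ≤ 2 ^ (k * primePi q) * N * ⌊log₂ N ⌋ ^ (k * primePi q)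
  bound N 2≤N = begin
    sumAbsH k q N ^ k       ≤⟨ ^-monoˡ-≤ k (sumAbsH≤ k q N) ⟩
    (B * A) ^ k             ≡⟨ ^-distrib-* B A k ⟩
    B ^ k * A ^ k           ≤⟨ *-mono-≤ (∑∣coeffInvZetaK∣^k≤ k N) (^-monoˡ-≤ k (∑∣coeffP∣≤ q≥1 N)) ⟩
    N * (suc L ^ π) ^ k     ≡⟨ cong (N *_) (trans (^-*-assoc (suc L) π k) (cong (suc L ^_) (*-comm π k))) ⟩
    N * suc L ^ E           ≤⟨ *-monoʳ-≤ N ([1+n]^e≤2^e*n^e E (⌊log₂⌋-mono-≤ 2≤N)) ⟩
    N * (2 ^ E * L ^ E)     ≡⟨ *-assoc N (2 ^ E) (L ^ E) ⟨
    N * 2 ^ E * L ^ E       ≡⟨ cong (_* L ^ E) (*-comm N (2 ^ E)) ⟩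
    2 ^ E * N * L ^ E       ∎
    where
    open ≤-Reasoning
    B A L π E : ℕ
    B = ∑[ i < N ] ∣ coeffInvZetaK k (suc i) ∣
    A = ∑[ i < N ] ∣ coeffP q (suc i) ∣
    L = ⌊log₂ N ⌋
    π = primePi q
    E = k * π
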